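{- Let $L$ be a primitive sublattice of $\mathbb{Z}_2\oplus\mathbb{Z}_2$ of multiplicity $d\in\mathbb{Z}_{\ge0}\cup\{\infty\}$. Then for each $i$ with $0\le i\le d$ (where $i=\infty$ is allowed if $d=\infty$) there exists exactly one primitive sublattice of $\mathbb{Z}_2\oplus\mathbb{Z}_2$ containing $L$ whose multiplicity equals $i$. Moreover: if $L$ contains a primitive vector $u$ with odd first coordinate and $i$ is finite, this lattice is generated by $u$ and $(0,2^i)$; if $L$ contains a primitive vector $w$ with odd second coordinate and $i$ is finite, this lattice is generated by $w$ and $(2^i,0)$; if $L$ contains a primitive vector $w$ and $i=d=\infty$, this lattice equals $L$, and $L$ is generated by $w$.
   Context: $\mathbb{Z}_2$ denotes the ring of $2$-adic integers and $\nu_2$ the $2$-adic valuation. A sublattice of $\mathbb{Z}_2\oplus\mathbb{Z}_2$ is a $\mathbb{Z}_2$-submodule generated by finitely many vectors (in this setting by at most two). Its multiplicity is $\nu_2$ of its index in $\mathbb{Z}_2\oplus\mathbb{Z}_2$ when it has rank $2$ (equivalently $\nu_2$ of the determinant of a basis), and $\infty$ when it has rank $<2$. A vector is primitive if at least one of its coordinates is odd; a sublattice is primitive if it contains a primitive vector. -}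

module Defs where

open import Data.Nat as ℕ using (ℕ; suc; _^_)
import Data.Nat.Divisibility as ℕD
open import Data.Integer using (ℤ; +_; _+_; _-_; _*_; -_; ∣_∣)
open import Data.Integer.Properties using (+-inverseʳ)
open import Data.Integer.Divisibility using (_∣_)
open import Data.Product using (Σ; _×_; _,_; proj₁; proj₂)
open import Data.Sum using (_⊎_)
open import Relation.Nullary using (¬_)
open import Relation.Binary.PropositionalEquality using (subst; sym; cong)

pow : ℕ → ℤ
pow n = + (2 ^ n)

_≡[_]_ : ℤ → ℕ → ℤ → Set
a ≡[ n ] b = pow n ∣ (a - b)

-- The 2-adic integers ℤ₂ = lim ℤ/2^n, modelled as coherent sequences of
-- integers: seq n represents the residue mod 2^n, and
-- seq (n+1) ≡ seq n (mod 2^n).  Equality is the setoid equality _≈_ below.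
record ℤ₂ : Set where
  constructor mkℤ₂
  field
    seq : ℕ → ℤ
    coh : ∀ n → seq (suc n) ≡[ n ] seq n
open ℤ₂ public

_≈ˢ_ : (ℕ → ℤ) → (ℕ → ℤ) → Set
f ≈ˢ g = ∀ n → f n ≡[ n ] g n

_≈_ : ℤ₂ → ℤ₂ → Set
x ≈ y = seq x ≈ˢ seq y

const₂ : ℤ → ℤ₂
const₂ c = mkℤ₂ (λ _ → c)
  (λ n → subst (λ z → pow n ∣ z) (sym (+-inverseʳ c)) ((2 ^ n) ℕD.∣0))

0₂ : ℤ₂
0₂ = const₂ (+ 0)

2^₂ : ℕ → ℤ₂
2^₂ i = const₂ (pow i)

V2 : Set
V2 = ℤ₂ × ℤ₂

Odd : ℤ₂ → Set
Odd x = ¬ (pow 1 ∣ seq x 1)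

Primitive : V2 → Set
Primitive (x , y) = Odd x ⊎ Odd y

-- A sublattice is given by (at most) two generators (pad with 0 if fewer).
Gens : Set
Gens = V2 × V2

_∈L_ : V2 → Gens → Set
(x , y) ∈L ((x₁ , y₁) , (x₂ , y₂)) =
  Σ ℤ₂ λ a → Σ ℤ₂ λ b →
    (seq x ≈ˢ (λ n → seq a n * seq x₁ n + seq b n * seq x₂ n)) ×
    (seq y ≈ˢ (λ n → seq a n * seq y₁ n + seq b n * seq y₂ n))

_⊆L_ : Gens → Gens → Set
M ⊆L M' = ∀ v → v ∈L M → v ∈L M'

_≐L_ : Gens → Gens → Set
M ≐L M' = (M ⊆L M') × (M' ⊆L M)

PrimitiveLat : Gens → Set
PrimitiveLat M = Σ V2 λ v → (v ∈L M) × Primitive v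

data ℕ∞ : Set where
  fin : ℕ → ℕ∞
  ∞   : ℕ∞

data _≤∞_ : ℕ∞ → ℕ∞ → Set where
  fin≤fin : ∀ {i d} → i ℕ.≤ d → fin i ≤∞ fin d
  fin≤∞   : ∀ {i} → fin i ≤∞ ∞
  ∞≤∞     : ∞ ≤∞ ∞

det : Gens → ℕ → ℤ
det ((x₁ , y₁) , (x₂ , y₂)) n = seq x₁ n * seq y₂ n - seq y₁ n * seq x₂ n

-- multiplicity: ν₂ of the determinant of the generators (a basis when the
-- rank is 2); ∞ iff the determinant is 0, i.e. the rank is < 2.
HasMult : Gens → ℕ∞ → Set
HasMult M (fin i) = (pow i ∣ det M i) × ¬ (pow (suc i) ∣ det M (suc i))
HasMult M ∞       = ∀ n → pow n ∣ det M n

Good : Gens → Gens → ℕ∞ → Set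
Good L M i = PrimitiveLat M × (L ⊆L M) × HasMult M i

-- If M has multiplicity i and contains a vector p with odd first coordinate, then p₁ is a
-- unit of ℤ₂ and det M = 2^i·e with e a unit. For v ∈ M, 2^i divides det(p, v) = p₁v₂ - p₂v₁,
-- so v = (v₁/p₁) p + b (0, 2^i); conversely (0, 2^i) ∈ M by Cramer's rule, as 2^i = det M / e.
-- Hence M = ⟨p, (0, 2^i)⟩ depends only on p and i, which gives uniqueness. This lattice has
-- determinant p₁·2^i and contains L as soon as 2^i divides det L, i.e. i ≤ d, which gives
-- existence. Multiplicity ∞ is the same argument with 2^i replaced by 0, and an odd second
-- coordinate reduces to an odd first one by exchanging the coordinates, which only changes
-- the sign of determinants.
module Submission where

open import Defs
open import Data.Nat using (ℕ)
open import Data.Product using (Σ; _×_; _,_; proj₁; proj₂)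
open import Relation.Binary.PropositionalEquality using (_≡_)

open import Data.Nat as ℕ using (zero; suc; _≤_; _∸_; z≤n; s≤s)
import Data.Nat.Properties as ℕP
import Data.Nat.Divisibility as ℕD
open import Data.Integer as ℤ using (ℤ; +_; _+_; _-_; _*_; -_)
import Data.Integer.Properties as ℤP
import Data.Integer.DivMod as ℤDM
import Data.Integer.Divisibility as U
import Data.Integer.Divisibility.Signed as S
open import Data.Integer.Tactic.RingSolver using (solve)
open import Data.List using (_∷_; [])
open import Data.Sum as Sum using (inj₁; inj₂)
open import Data.Empty using (⊥-elim)
open import Function using (_∘_)
open import Relation.Nullary using (¬_)
open import Relation.Binary.Bundles using (Setoid)
import Relation.Binary.Reasoning.Setoid as SetoidReasoning
open import Level using (0ℓ)
open import Relation.Binary.PropositionalEquality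
  using (refl; sym; trans; cong; subst; subst₂; module ≡-Reasoning)

private variable
  m n i : ℕ
  a a′ a₁ a₂ a₃ b b′ b₁ b₂ b₃ c y y′ : ℤ

-- Congruences modulo powers of 2

-- A copy of _≡[_]_ whose type constructor is injective, so that a and b can be
-- inferred from a proof (_≡[_]_ unfolds through absolute values).
infix 4 _≋[_]_ _≋ˢ_

record _≋[_]_ (a : ℤ) (n : ℕ) (b : ℤ) : Set where
  constructor ≋-intro
  field 2^n∣a-b : pow n S.∣ a - b

_≋ˢ_ : (ℕ → ℤ) → (ℕ → ℤ) → Set
f ≋ˢ g = ∀ n → f n ≋[ n ] g n

≡[]⇒≋ : a ≡[ n ] b → a ≋[ n ] b
≡[]⇒≋ p = ≋-intro (S.∣ᵤ⇒∣ p)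

≋⇒≡[] : a ≋[ n ] b → a ≡[ n ] b
≋⇒≡[] (≋-intro p) = S.∣⇒∣ᵤ p

∣⇒≋0 : pow n S.∣ a → a ≋[ n ] + 0
∣⇒≋0 {n = n} {a = a} p = ≋-intro (subst (pow n S.∣_) (sym (ℤP.+-identityʳ a)) p)

≋0⇒∣ : a ≋[ n ] + 0 → pow n S.∣ a
≋0⇒∣ {a = a} {n = n} (≋-intro p) = subst (pow n S.∣_) (ℤP.+-identityʳ a) p

≋-lincomb₁ : ∀ k → a₁ ≋[ n ] b₁ → a - b ≡ k * (a₁ - b₁) → a ≋[ n ] b
≋-lincomb₁ {n = n} k (≋-intro p) eq = ≋-intro (subst (pow n S.∣_) (sym eq) (S.∣n⇒∣m*n k p))

≋-lincomb₂ : ∀ k₁ k₂ → a₁ ≋[ n ] b₁ → a₂ ≋[ n ] b₂ →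
             a - b ≡ k₁ * (a₁ - b₁) + k₂ * (a₂ - b₂) → a ≋[ n ] b
≋-lincomb₂ {n = n} k₁ k₂ (≋-intro p) (≋-intro q) eq = ≋-intro (subst (pow n S.∣_) (sym eq)
  (S.∣m∣n⇒∣m+n (S.∣n⇒∣m*n k₁ p) (S.∣n⇒∣m*n k₂ q)))

≋-lincomb₃ : ∀ k₁ k₂ k₃ → a₁ ≋[ n ] b₁ → a₂ ≋[ n ] b₂ → a₃ ≋[ n ] b₃ →
             a - b ≡ k₁ * (a₁ - b₁) + k₂ * (a₂ - b₂) + k₃ * (a₃ - b₃) → a ≋[ n ] b
≋-lincomb₃ {n = n} k₁ k₂ k₃ (≋-intro p) (≋-intro q) (≋-intro r) eq = ≋-intro (subst (pow n S.∣_) (sym eq)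
  (S.∣m∣n⇒∣m+n (S.∣m∣n⇒∣m+n (S.∣n⇒∣m*n k₁ p) (S.∣n⇒∣m*n k₂ q)) (S.∣n⇒∣m*n k₃ r)))

≋-refl : a ≋[ n ] a
≋-refl {a = a} = ≋-intro (S.divides (+ 0) (ℤP.+-inverseʳ a))

≋-reflexive : a ≡ b → a ≋[ n ] b
≋-reflexive refl = ≋-refl

≋-sym : a ≋[ n ] b → b ≋[ n ] a
≋-sym {a = a} {b = b} p = ≋-lincomb₁ (- + 1) p (solve (a ∷ b ∷ []))

≋-trans : a ≋[ n ] b → b ≋[ n ] c → a ≋[ n ] c
≋-trans {a = a} {b = b} {c = c} p q = ≋-lincomb₂ (+ 1) (+ 1) p q (solve (a ∷ b ∷ c ∷ []))

≋-setoid : ℕ → Setoid 0ℓ 0ℓ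
≋-setoid n = record
  { Carrier       = ℤ
  ; _≈_           = _≋[ n ]_
  ; isEquivalence = record { refl = ≋-refl ; sym = ≋-sym ; trans = ≋-trans }
  }

module ≋-Reasoning (n : ℕ) = SetoidReasoning (≋-setoid n)

≋-+ : a ≋[ n ] a′ → b ≋[ n ] b′ → a + b ≋[ n ] a′ + b′
≋-+ {a = a} {a′ = a′} {b = b} {b′ = b′} p q =
  ≋-lincomb₂ (+ 1) (+ 1) p q (solve (a ∷ a′ ∷ b ∷ b′ ∷ []))

≋-* : a ≋[ n ] a′ → b ≋[ n ] b′ → a * b ≋[ n ] a′ * b′
≋-* {a = a} {a′ = a′} {b = b} {b′ = b′} p q =
  ≋-lincomb₂ b a′ p q (solve (a ∷ a′ ∷ b ∷ b′ ∷ []))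

≋-neg : a ≋[ n ] a′ → - a ≋[ n ] - a′
≋-neg {a = a} {a′ = a′} p = ≋-lincomb₁ (- + 1) p (solve (a ∷ a′ ∷ []))

pow-+ : ∀ m n → pow (m ℕ.+ n) ≡ pow m * pow n
pow-+ m n = trans (cong +_ (ℕP.^-distribˡ-+-* 2 m n)) (ℤP.pos-* (2 ℕ.^ m) (2 ℕ.^ n))

pow-mono-∣ : m ≤ n → pow m S.∣ pow n
pow-mono-∣ {m} {n} m≤n = S.divides (pow (n ∸ m)) (begin
  pow n                   ≡⟨ cong pow (ℕP.m+[n∸m]≡n m≤n) ⟨
  pow (m ℕ.+ (n ∸ m))     ≡⟨ pow-+ m (n ∸ m) ⟩
  pow m * pow (n ∸ m)     ≡⟨ ℤP.*-comm (pow m) (pow (n ∸ m)) ⟩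
  pow (n ∸ m) * pow m     ∎)
  where open ≡-Reasoning

≋-weaken : m ≤ n → a ≋[ n ] b → a ≋[ m ] b
≋-weaken m≤n (≋-intro p) = ≋-intro (S.∣-trans (pow-mono-∣ m≤n) p)

pow-∣-* : pow m S.∣ a → pow n S.∣ b → pow (m ℕ.+ n) S.∣ a * b
pow-∣-* {m} {n = n} (S.divides q refl) (S.divides r refl) = S.divides (q * r)
  (trans (regroup q r (pow m) (pow n)) (cong ((q * r) *_) (sym (pow-+ m n))))
  where
  regroup : ∀ q r x y → (q * x) * (r * y) ≡ (q * r) * (x * y)
  regroup q r x y = solve (q ∷ r ∷ x ∷ y ∷ [])

*-distribʳ-- : ∀ a b x → (a - b) * x ≡ a * x - b * x
*-distribʳ-- a b x = solve (a ∷ b ∷ x ∷ [])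

≋-*-pow : a ≋[ n ] b → a * pow i ≋[ n ℕ.+ i ] b * pow i
≋-*-pow {a = a} {n = n} {b = b} {i = i} (≋-intro p) =
  ≋-intro (subst (pow (n ℕ.+ i) S.∣_) (*-distribʳ-- a b (pow i)) (pow-∣-* {m = n} {n = i} p S.∣-refl))

≋-cancel-pow : a * pow i ≋[ n ℕ.+ i ] b * pow i → a ≋[ n ] b
≋-cancel-pow {a = a} {i = i} {n = n} {b = b} (≋-intro p) = ≡[]⇒≋
  (U.*-cancelʳ-∣ (pow i) {pow n} {a - b} {{ℕP.m^n≢0 2 i}}
    (S.∣⇒∣ᵤ (subst₂ S._∣_ (pow-+ n i) (sym (*-distribʳ-- a b (pow i))) p)))

coh≋ : ∀ x n → seq x (suc n) ≋[ n ] seq x n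
coh≋ x n = ≡[]⇒≋ (coh x n)

seq-coherent : ∀ x {m n} → m ≤ n → seq x n ≋[ m ] seq x m
seq-coherent x {n = zero} z≤n = ≋-refl
seq-coherent x {n = suc n} m≤1+n with ℕP.m≤n⇒m<n∨m≡n m≤1+n
... | inj₁ (s≤s m≤n) = ≋-trans (≋-weaken m≤n (coh≋ x n)) (seq-coherent x m≤n)
... | inj₂ refl      = ≋-refl

infixl 6 _⊕_ _⊖_
infixl 7 _⊗_

_⊕_ : ℤ₂ → ℤ₂ → ℤ₂
x ⊕ y = mkℤ₂ (λ n → seq x n + seq y n) (λ n → ≋⇒≡[] (≋-+ (coh≋ x n) (coh≋ y n)))

_⊗_ : ℤ₂ → ℤ₂ → ℤ₂
x ⊗ y = mkℤ₂ (λ n → seq x n * seq y n) (λ n → ≋⇒≡[] (≋-* (coh≋ x n) (coh≋ y n)))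

⊝_ : ℤ₂ → ℤ₂
⊝ x = mkℤ₂ (λ n → - seq x n) (λ n → ≋⇒≡[] (≋-neg (coh≋ x n)))

_⊖_ : ℤ₂ → ℤ₂ → ℤ₂
x ⊖ y = x ⊕ ⊝ y

1₂ : ℤ₂
1₂ = const₂ (+ 1)

-- Units of ℤ₂

1₂-odd : Odd 1₂
1₂-odd 2∣1 with ℕD.∣1⇒≡1 2∣1
... | ()

¬2∣⇒≋1 : ¬ (pow 1 U.∣ a) → a ≋[ 1 ] + 1
¬2∣⇒≋1 {a = a} a-odd with a ℤ.% + 2 | a ℤ./ + 2 | ℤDM.n%d<d a (+ 2) | ℤDM.a≡a%n+[a/n]*n a (+ 2)
... | 0           | q | _             | a≡2q   =
  ⊥-elim (a-odd (S.∣⇒∣ᵤ (S.divides q (trans a≡2q (ℤP.+-identityˡ (q * + 2))))))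
... | 1           | q | _             | a≡1+2q =
  ≋-intro (S.divides q (trans (cong (_- + 1) a≡1+2q) (cancel (q * + 2))))
  where
  cancel : ∀ x → + 1 + x - + 1 ≡ x
  cancel x = solve (x ∷ [])
... | suc (suc _) | _ | s≤s (s≤s ()) | _

Odd⇒seq≋1 : ∀ {x} → Odd x → ∀ n → seq x (suc n) ≋[ 1 ] + 1
Odd⇒seq≋1 {x} x-odd n = ≋-trans (seq-coherent x (s≤s z≤n)) (¬2∣⇒≋1 x-odd)

-- Newton's iteration y ↦ y (2 - a y) for 1/a: the error 1 - a y is squared.
newton-step : ∀ a y → a * y ≋[ suc n ] + 1 → a * (y * (+ 2 - a * y)) ≋[ suc (suc n) ] + 1
newton-step {n = n} a y (≋-intro p) =
  ≋-lincomb₁ (- + 1) (≋-weaken (s≤s (ℕP.m≤n+m (suc n) n)) (∣⇒≋0 (pow-∣-* {m = suc n} {n = suc n} p p)))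
    (solve (a ∷ y ∷ []))

≋1⇒invertible : a ≋[ 1 ] + 1 → ∀ n → Σ ℤ λ y → a * y ≋[ suc n ] + 1
≋1⇒invertible {a = a} a≋1 zero = + 1 , ≋-trans (≋-reflexive (ℤP.*-identityʳ a)) a≋1
≋1⇒invertible {a = a} a≋1 (suc n) with ≋1⇒invertible a≋1 n
... | y , ay≋1 = y * (+ 2 - a * y) , newton-step a y ay≋1

inverse-unique : a * y ≋[ n ] + 1 → a′ * y′ ≋[ n ] + 1 → a ≋[ n ] a′ → y ≋[ n ] y′
inverse-unique {a = a} {y = y} {a′ = a′} {y′ = y′} ay≋1 a′y′≋1 a≋a′ =
  ≋-lincomb₃ y′ (- y) (- (y * y′)) ay≋1 a′y′≋1 a≋a′ (solve (a ∷ y ∷ a′ ∷ y′ ∷ []))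

module _ (x : ℤ₂) (x-odd : Odd x) where
  private
    -- Level n inverts seq x (suc n): seq x 0 carries no parity information.
    approx : ∀ n → Σ ℤ λ y → seq x (suc n) * y ≋[ suc n ] + 1
    approx n = ≋1⇒invertible (Odd⇒seq≋1 {x} x-odd n) n

    approx-inverse : ∀ n → seq x n * proj₁ (approx n) ≋[ n ] + 1
    approx-inverse n =
      ≋-trans (≋-* (≋-sym (coh≋ x n)) (≋-refl {a = proj₁ (approx n)})) (≋-weaken (ℕP.n≤1+n n) (proj₂ (approx n)))

    approx-coherent : ∀ n → proj₁ (approx (suc n)) ≋[ n ] proj₁ (approx n)
    approx-coherent n =
      inverse-unique {a = seq x (suc n)} {y = proj₁ (approx (suc n))}
                     {a′ = seq x n} {y′ = proj₁ (approx n)}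
        (≋-weaken (ℕP.n≤1+n n) (approx-inverse (suc n))) (approx-inverse n) (coh≋ x n)

  inv₂ : ℤ₂
  inv₂ = mkℤ₂ (λ n → proj₁ (approx n)) (λ n → ≋⇒≡[] (approx-coherent n))

  inv₂-inverse : seq (x ⊗ inv₂) ≋ˢ seq 1₂
  inv₂-inverse = approx-inverse

-- 2-adic valuation

HasValuation : ℤ₂ → ℕ → Set
HasValuation x i = pow i U.∣ seq x i × ¬ (pow (suc i) U.∣ seq x (suc i))

module _ (x : ℤ₂) (i : ℕ) (2^i∣xᵢ : pow i U.∣ seq x i) where
  private
    2^i∣x : ∀ n → pow i S.∣ seq x (n ℕ.+ i)
    2^i∣x n = ≋0⇒∣ (≋-trans (seq-coherent x (ℕP.m≤n+m i n)) (∣⇒≋0 (S.∣ᵤ⇒∣ 2^i∣xᵢ)))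

    q : ℕ → ℤ
    q n = S.quotient (2^i∣x n)

    x≡q*2^i : ∀ n → seq x (n ℕ.+ i) ≡ q n * pow i
    x≡q*2^i n = S._∣_.equality (2^i∣x n)

    q-coherent : ∀ n → q (suc n) ≋[ n ] q n
    q-coherent n = ≋-cancel-pow (subst₂ _≋[ n ℕ.+ i ]_ (x≡q*2^i (suc n)) (x≡q*2^i n) (coh≋ x (n ℕ.+ i)))

  quotient₂ : ℤ₂
  quotient₂ = mkℤ₂ q (λ n → ≋⇒≡[] (q-coherent n))

  quotient₂-spec : seq x ≋ˢ seq (2^₂ i ⊗ quotient₂)
  quotient₂-spec n = ≋-trans (≋-sym (seq-coherent x (ℕP.m≤m+n n i)))
    (≋-reflexive (trans (x≡q*2^i n) (ℤP.*-comm (q n) (pow i))))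

valuation⇒unit-multiple : ∀ {x} → HasValuation x i → Σ ℤ₂ λ e → Odd e × seq x ≋ˢ seq (2^₂ i ⊗ e)
valuation⇒unit-multiple {i} {x} (2^i∣xᵢ , 2^[1+i]∤x₁₊ᵢ) = e , e-odd , quotient₂-spec x i 2^i∣xᵢ
  where
  e = quotient₂ x i 2^i∣xᵢ
  e-odd : Odd e
  e-odd 2∣e₁ = 2^[1+i]∤x₁₊ᵢ (S.∣⇒∣ᵤ (≋0⇒∣ (begin
    seq x (suc i)         ≈⟨ quotient₂-spec x i 2^i∣xᵢ (suc i) ⟩
    pow i * seq e (suc i) ≡⟨ ℤP.*-comm (pow i) (seq e (suc i)) ⟩
    seq e (suc i) * pow i ≈⟨ ≋-*-pow {n = 1} (≋-trans (seq-coherent e (s≤s z≤n)) (∣⇒≋0 (S.∣ᵤ⇒∣ 2∣e₁))) ⟩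
    + 0                   ∎)))
    where open ≋-Reasoning (suc i)

unit-multiple⇒valuation : ∀ {x e} → Odd e → seq x ≋ˢ seq (2^₂ i ⊗ e) → HasValuation x i
unit-multiple⇒valuation {i} {x} {e} e-odd x≋2^ie = 2^i∣xᵢ , 2^[1+i]∤x₁₊ᵢ
  where
  2^i∣xᵢ : pow i U.∣ seq x i
  2^i∣xᵢ = S.∣⇒∣ᵤ (≋0⇒∣ (≋-trans (x≋2^ie i) (∣⇒≋0 (S.∣m⇒∣m*n (seq e i) S.∣-refl))))

  2^[1+i]∤x₁₊ᵢ : ¬ (pow (suc i) U.∣ seq x (suc i))
  2^[1+i]∤x₁₊ᵢ 2^[1+i]∣x₁₊ᵢ =
    e-odd (S.∣⇒∣ᵤ (≋0⇒∣ (≋-trans (≋-sym (seq-coherent e (s≤s z≤n))) (≋-cancel-pow {n = 1} e₁₊ᵢ*2^i≋0))))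
    where
    e₁₊ᵢ*2^i≋0 : seq e (suc i) * pow i ≋[ suc i ] + 0
    e₁₊ᵢ*2^i≋0 = begin
      seq e (suc i) * pow i ≡⟨ ℤP.*-comm (seq e (suc i)) (pow i) ⟩
      pow i * seq e (suc i) ≈⟨ x≋2^ie (suc i) ⟨
      seq x (suc i)         ≈⟨ ∣⇒≋0 (S.∣ᵤ⇒∣ 2^[1+i]∣x₁₊ᵢ) ⟩
      + 0                   ∎
      where open ≋-Reasoning (suc i)

det₂ : Gens → ℤ₂
det₂ ((x₁ , y₁) , (x₂ , y₂)) = x₁ ⊗ y₂ ⊖ y₁ ⊗ x₂

2^₂∞ : ℕ∞ → ℤ₂
2^₂∞ (fin i) = 2^₂ i
2^₂∞ ∞       = 0₂

mult⇒unit-multiple : ∀ M {i} → HasMult M i → Σ ℤ₂ λ e → Odd e × det M ≋ˢ seq (2^₂∞ i ⊗ e)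
mult⇒unit-multiple M {fin i} M-mult = valuation⇒unit-multiple {x = det₂ M} M-mult
mult⇒unit-multiple M {∞}     M-mult = 1₂ , 1₂-odd , λ n → ∣⇒≋0 (S.∣ᵤ⇒∣ (M-mult n))

mult⇒pow-∣det : ∀ L {d j} → HasMult L d → fin j ≤∞ d → Σ ℤ₂ λ c → det L ≋ˢ seq (2^₂ j ⊗ c)
mult⇒pow-∣det L {fin d} {j} L-mult (fin≤fin j≤d) =
  let e , _ , det≋ = mult⇒unit-multiple L L-mult
  in 2^₂ (d ∸ j) ⊗ e , λ n → ≋-trans (det≋ n) (≋-reflexive (split (seq e n)))
  where
  split : ∀ x → pow d * x ≡ pow j * (pow (d ∸ j) * x)
  split x = begin
    pow d * x                   ≡⟨ cong (λ k → pow k * x) (ℕP.m+[n∸m]≡n j≤d) ⟨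
    pow (j ℕ.+ (d ∸ j)) * x     ≡⟨ cong (_* x) (pow-+ j (d ∸ j)) ⟩
    pow j * pow (d ∸ j) * x     ≡⟨ ℤP.*-assoc (pow j) (pow (d ∸ j)) x ⟩
    pow j * (pow (d ∸ j) * x)   ∎
    where open ≡-Reasoning
mult⇒pow-∣det L {∞} {j} L-mult fin≤∞ =
  0₂ , λ n → ≋-trans (∣⇒≋0 (S.∣ᵤ⇒∣ (L-mult n))) (≋-reflexive (sym (ℤP.*-zeroʳ (pow j))))

-- Membership with rigid congruences, so that implicit arguments can be inferred.
_∈≋_ : V2 → Gens → Set
(x , y) ∈≋ ((x₁ , y₁) , (x₂ , y₂)) =
  Σ ℤ₂ λ a → Σ ℤ₂ λ b → (seq x ≋ˢ seq (a ⊗ x₁ ⊕ b ⊗ x₂)) × (seq y ≋ˢ seq (a ⊗ y₁ ⊕ b ⊗ y₂))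

∈L⇒∈≋ : ∀ v M → v ∈L M → v ∈≋ M
∈L⇒∈≋ _ _ (a , b , x≈ , y≈) = a , b , (λ n → ≡[]⇒≋ (x≈ n)) , (λ n → ≡[]⇒≋ (y≈ n))

∈≋⇒∈L : ∀ v M → v ∈≋ M → v ∈L M
∈≋⇒∈L _ _ (a , b , x≋ , y≋) = a , b , (λ n → ≋⇒≡[] (x≋ n)) , (λ n → ≋⇒≡[] (y≋ n))

∈L-first : ∀ g₁ g₂ → g₁ ∈L (g₁ , g₂)
∈L-first (x₁ , y₁) (x₂ , y₂) = ∈≋⇒∈L (x₁ , y₁) ((x₁ , y₁) , (x₂ , y₂))
  (1₂ , 0₂ , (λ n → ≋-reflexive (unit (seq x₁ n) (seq x₂ n)))
           , (λ n → ≋-reflexive (unit (seq y₁ n) (seq y₂ n))))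
  where
  unit : ∀ g h → g ≡ + 1 * g + + 0 * h
  unit g h = solve (g ∷ h ∷ [])

∈≋-trans : ∀ M g₁ g₂ v → g₁ ∈≋ M → g₂ ∈≋ M → v ∈≋ (g₁ , g₂) → v ∈≋ M
∈≋-trans ((x₁ , y₁) , (x₂ , y₂)) _ _ _ (c , d , g₁x , g₁y) (e , f , g₂x , g₂y) (a , b , vx , vy) =
  a ⊗ c ⊕ b ⊗ e , a ⊗ d ⊕ b ⊗ f ,
  (λ n → substitute (seq a n) (seq b n) (seq c n) (seq d n) (seq e n) (seq f n) (seq x₁ n) (seq x₂ n)
                    (vx n) (g₁x n) (g₂x n)) ,
  (λ n → substitute (seq a n) (seq b n) (seq c n) (seq d n) (seq e n) (seq f n) (seq y₁ n) (seq y₂ n)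
                    (vy n) (g₁y n) (g₂y n))
  where
  substitute : ∀ {n X G₁ G₂} a b c d e f M₁ M₂ →
    X ≋[ n ] a * G₁ + b * G₂ → G₁ ≋[ n ] c * M₁ + d * M₂ → G₂ ≋[ n ] e * M₁ + f * M₂ →
    X ≋[ n ] (a * c + b * e) * M₁ + (a * d + b * f) * M₂
  substitute a b c d e f M₁ M₂ X≋ G₁≋ G₂≋ =
    ≋-trans X≋ (≋-trans (≋-+ (≋-* (≋-refl {a = a}) G₁≋) (≋-* (≋-refl {a = b}) G₂≋))
                        (≋-reflexive (solve (a ∷ b ∷ c ∷ d ∷ e ∷ f ∷ M₁ ∷ M₂ ∷ []))))

span-⊆ : ∀ g₁ g₂ M → g₁ ∈L M → g₂ ∈L M → (g₁ , g₂) ⊆L M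
span-⊆ g₁ g₂ M g₁∈M g₂∈M v v∈span = ∈≋⇒∈L v M
  (∈≋-trans M g₁ g₂ v (∈L⇒∈≋ g₁ M g₁∈M) (∈L⇒∈≋ g₂ M g₂∈M) (∈L⇒∈≋ v (g₁ , g₂) v∈span))

det-of-members : ∀ M v w → v ∈≋ M → w ∈≋ M → Σ ℤ₂ λ k → det (v , w) ≋ˢ seq (k ⊗ det₂ M)
det-of-members ((x₁ , y₁) , (x₂ , y₂)) _ _ (a , b , v₁ , v₂) (c , d , w₁ , w₂) =
  a ⊗ d ⊖ b ⊗ c , λ n →
    bilinear (seq a n) (seq b n) (seq c n) (seq d n) (seq x₁ n) (seq y₁ n) (seq x₂ n) (seq y₂ n)
             (v₁ n) (v₂ n) (w₁ n) (w₂ n)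
  where
  bilinear : ∀ {n V₁ V₂ W₁ W₂} a b c d X₁ Y₁ X₂ Y₂ →
    V₁ ≋[ n ] a * X₁ + b * X₂ → V₂ ≋[ n ] a * Y₁ + b * Y₂ →
    W₁ ≋[ n ] c * X₁ + d * X₂ → W₂ ≋[ n ] c * Y₁ + d * Y₂ →
    V₁ * W₂ - V₂ * W₁ ≋[ n ] (a * d - b * c) * (X₁ * Y₂ - Y₁ * X₂)
  bilinear a b c d X₁ Y₁ X₂ Y₂ V₁≋ V₂≋ W₁≋ W₂≋ = ≋-trans (≋-+ (≋-* V₁≋ W₂≋) (≋-neg (≋-* V₂≋ W₁≋)))
    (≋-reflexive (solve (a ∷ b ∷ c ∷ d ∷ X₁ ∷ Y₁ ∷ X₂ ∷ Y₂ ∷ [])))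

det-members-∣ : ∀ M v w z c → det M ≋ˢ seq (z ⊗ c) → v ∈L M → w ∈L M →
                Σ ℤ₂ λ c′ → det (v , w) ≋ˢ seq (z ⊗ c′)
det-members-∣ M v w z c det≋ v∈M w∈M =
  let k , det[v,w]≋ = det-of-members M v w (∈L⇒∈≋ v M v∈M) (∈L⇒∈≋ w M w∈M)
  in k ⊗ c , λ n → ≋-trans (det[v,w]≋ n)
       (≋-trans (≋-* (≋-refl {a = seq k n}) (det≋ n))
                (≋-reflexive (swap-factors (seq k n) (seq z n) (seq c n))))
  where
  swap-factors : ∀ k z c → k * (z * c) ≡ z * (k * c)
  swap-factors k z c = solve (k ∷ z ∷ c ∷ [])

∈-span-odd₁ : ∀ p v z c → Odd (proj₁ p) → det (p , v) ≋ˢ seq (z ⊗ c) → v ∈L (p , (0₂ , z))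
∈-span-odd₁ (p₁ , p₂) (v₁ , v₂) z c p₁-odd det≋ = ∈≋⇒∈L (v₁ , v₂) ((p₁ , p₂) , (0₂ , z))
  (v₁ ⊗ q , q ⊗ c ,
   (λ n → first (seq v₁ n) (seq q n) (seq p₁ n) (seq c n) (inv₂-inverse p₁ p₁-odd n)) ,
   (λ n → second (seq v₁ n) (seq v₂ n) (seq q n) (seq p₁ n) (seq p₂ n) (seq c n) (seq z n)
                 (inv₂-inverse p₁ p₁-odd n) (det≋ n)))
  where
  q = inv₂ p₁ p₁-odd

  first : ∀ {n} V₁ Q P₁ C → P₁ * Q ≋[ n ] + 1 → V₁ ≋[ n ] V₁ * Q * P₁ + Q * C * + 0
  first V₁ Q P₁ C P₁Q≋1 = ≋-lincomb₁ (- V₁) P₁Q≋1 (solve (V₁ ∷ Q ∷ P₁ ∷ C ∷ []))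

  second : ∀ {n} V₁ V₂ Q P₁ P₂ C Z → P₁ * Q ≋[ n ] + 1 → P₁ * V₂ - P₂ * V₁ ≋[ n ] Z * C →
           V₂ ≋[ n ] V₁ * Q * P₂ + Q * C * Z
  second V₁ V₂ Q P₁ P₂ C Z P₁Q≋1 det≋ =
    ≋-lincomb₂ (- V₂) Q P₁Q≋1 det≋ (solve (V₁ ∷ V₂ ∷ Q ∷ P₁ ∷ P₂ ∷ C ∷ Z ∷ []))

[0,z]∈L : ∀ M z e → Odd e → det M ≋ˢ seq (z ⊗ e) → (0₂ , z) ∈L M
[0,z]∈L ((x₁ , y₁) , (x₂ , y₂)) z e e-odd det≋ = ∈≋⇒∈L (0₂ , z) ((x₁ , y₁) , (x₂ , y₂))
  (⊝ (x₂ ⊗ r) , x₁ ⊗ r ,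
   (λ n → ≋-reflexive (first (seq x₁ n) (seq x₂ n) (seq r n))) ,
   (λ n → second (seq x₁ n) (seq y₁ n) (seq x₂ n) (seq y₂ n) (seq r n) (seq z n) (seq e n)
                 (det≋ n) (inv₂-inverse e e-odd n)))
  where
  r = inv₂ e e-odd

  first : ∀ X₁ X₂ R → + 0 ≡ - (X₂ * R) * X₁ + X₁ * R * X₂
  first X₁ X₂ R = solve (X₁ ∷ X₂ ∷ R ∷ [])

  second : ∀ {n} X₁ Y₁ X₂ Y₂ R Z E → X₁ * Y₂ - Y₁ * X₂ ≋[ n ] Z * E → E * R ≋[ n ] + 1 →
           Z ≋[ n ] - (X₂ * R) * Y₁ + X₁ * R * Y₂
  second X₁ Y₁ X₂ Y₂ R Z E det≋ ER≋1 =
    ≋-lincomb₂ (- R) (- Z) det≋ ER≋1 (solve (X₁ ∷ Y₁ ∷ X₂ ∷ Y₂ ∷ R ∷ Z ∷ E ∷ []))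

⊆-span-odd₁ : ∀ L p z c → det L ≋ˢ seq (z ⊗ c) → p ∈L L → Odd (proj₁ p) → L ⊆L (p , (0₂ , z))
⊆-span-odd₁ L p z c det≋ p∈L p₁-odd v v∈L =
  let c′ , det[p,v]≋ = det-members-∣ L p v z c det≋ p∈L v∈L
  in ∈-span-odd₁ p v z c′ p₁-odd det[p,v]≋

span-odd₁ : ∀ M {i} p → HasMult M i → p ∈L M → Odd (proj₁ p) → M ≐L (p , (0₂ , 2^₂∞ i))
span-odd₁ M {i} p M-mult p∈M p₁-odd =
  let e , e-odd , det≋ = mult⇒unit-multiple M M-mult
  in ⊆-span-odd₁ M p (2^₂∞ i) e det≋ p∈M p₁-odd ,
     span-⊆ p (0₂ , 2^₂∞ i) M p∈M ([0,z]∈L M (2^₂∞ i) e e-odd det≋)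

good-odd₁ : ∀ L {d j} u → HasMult L d → fin j ≤∞ d → u ∈L L → Odd (proj₁ u) →
            Good L (u , (0₂ , 2^₂ j)) (fin j)
good-odd₁ L {j = j} (u₁ , u₂) L-mult j≤d u∈L u₁-odd =
  let c , det≋ = mult⇒pow-∣det L L-mult j≤d in
  ((u₁ , u₂) , ∈L-first (u₁ , u₂) (0₂ , 2^₂ j) , inj₁ u₁-odd) ,
  ⊆-span-odd₁ L (u₁ , u₂) (2^₂ j) c det≋ u∈L u₁-odd ,
  unit-multiple⇒valuation {x = det₂ ((u₁ , u₂) , (0₂ , 2^₂ j))} {e = u₁} u₁-odd
    (λ n → ≋-reflexive (det-eq (seq u₁ n) (seq u₂ n) (pow j)))
  where
  det-eq : ∀ u₁ u₂ z → u₁ * z - u₂ * + 0 ≡ z * u₁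
  det-eq u₁ u₂ z = solve (u₁ ∷ u₂ ∷ z ∷ [])

-- Exchanging the two coordinates

swapV : V2 → V2
swapV (x , y) = y , x

swapG : Gens → Gens
swapG (g₁ , g₂) = swapV g₁ , swapV g₂

∈L-swap : ∀ v M → v ∈L M → swapV v ∈L swapG M
∈L-swap _ _ (a , b , x≈ , y≈) = a , b , y≈ , x≈

⊆L-swap : ∀ M M′ → M ⊆L M′ → swapG M ⊆L swapG M′
⊆L-swap M M′ M⊆M′ v v∈M = ∈L-swap (swapV v) M′ (M⊆M′ (swapV v) (∈L-swap v (swapG M) v∈M))

≐L-swap : ∀ M M′ → M ≐L M′ → swapG M ≐L swapG M′
≐L-swap M M′ (M⊆M′ , M′⊆M) = ⊆L-swap M M′ M⊆M′ , ⊆L-swap M′ M M′⊆M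

pow-∣-det-swap : ∀ M i n → pow i U.∣ det M n → pow i U.∣ det (swapG M) n
pow-∣-det-swap ((x₁ , y₁) , (x₂ , y₂)) i n 2^i∣det =
  subst (λ t → 2 ℕ.^ i ℕD.∣ ℤ.∣ t ∣) (sym (negate (seq x₁ n) (seq y₁ n) (seq x₂ n) (seq y₂ n)))
        (subst (2 ℕ.^ i ℕD.∣_) (sym (ℤP.∣-i∣≡∣i∣ (det ((x₁ , y₁) , (x₂ , y₂)) n))) 2^i∣det)
  where
  negate : ∀ x₁ y₁ x₂ y₂ → y₁ * x₂ - x₁ * y₂ ≡ - (x₁ * y₂ - y₁ * x₂)
  negate x₁ y₁ x₂ y₂ = solve (x₁ ∷ y₁ ∷ x₂ ∷ y₂ ∷ [])

HasMult-swap : ∀ M i → HasMult M i → HasMult (swapG M) i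
HasMult-swap M (fin i) (2^i∣det , 2^[1+i]∤det) =
  pow-∣-det-swap M i i 2^i∣det , λ h → 2^[1+i]∤det (pow-∣-det-swap (swapG M) (suc i) (suc i) h)
HasMult-swap M ∞ M-mult = λ n → pow-∣-det-swap M n n (M-mult n)

Good-swap : ∀ L M i → Good L M i → Good (swapG L) (swapG M) i
Good-swap L M i ((v , v∈M , v-prim) , L⊆M , M-mult) =
  (swapV v , ∈L-swap v M v∈M , Sum.swap v-prim) , ⊆L-swap L M L⊆M , HasMult-swap M i M-mult

span-odd₂ : ∀ M {i} p → HasMult M i → p ∈L M → Odd (proj₂ p) → M ≐L (p , (2^₂∞ i , 0₂))
span-odd₂ M {i} p M-mult p∈M p₂-odd = ≐L-swap (swapG M) (swapV p , (0₂ , 2^₂∞ i))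
  (span-odd₁ (swapG M) (swapV p) (HasMult-swap M i M-mult) (∈L-swap p M p∈M) p₂-odd)

good-odd₂ : ∀ L {d j} w → HasMult L d → fin j ≤∞ d → w ∈L L → Odd (proj₂ w) →
            Good L (w , (2^₂ j , 0₂)) (fin j)
good-odd₂ L {d} {j} w L-mult j≤d w∈L w₂-odd = Good-swap (swapG L) (swapV w , (0₂ , 2^₂ j)) (fin j)
  (good-odd₁ (swapG L) (swapV w) (HasMult-swap L d L-mult) j≤d (∈L-swap w L w∈L) w₂-odd)

≐L-sym : ∀ M M′ → M ≐L M′ → M′ ≐L M
≐L-sym _ _ (M⊆M′ , M′⊆M) = M′⊆M , M⊆M′

≐L-trans : ∀ M M′ M″ → M ≐L M′ → M′ ≐L M″ → M ≐L M″
≐L-trans _ _ _ (M⊆M′ , M′⊆M) (M′⊆M″ , M″⊆M′) = (λ v → M′⊆M″ v ∘ M⊆M′ v) , (λ v → M′⊆M v ∘ M″⊆M′ v)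

canonical-gens : (p : V2) → Primitive p → ℤ₂ → Gens
canonical-gens p (inj₁ _) z = p , (0₂ , z)
canonical-gens p (inj₂ _) z = p , (z , 0₂)

span-primitive : ∀ M {i} p → HasMult M i → p ∈L M → (p-prim : Primitive p) →
                 M ≐L canonical-gens p p-prim (2^₂∞ i)
span-primitive M p M-mult p∈M (inj₁ p₁-odd) = span-odd₁ M p M-mult p∈M p₁-odd
span-primitive M p M-mult p∈M (inj₂ p₂-odd) = span-odd₂ M p M-mult p∈M p₂-odd

good-unique : ∀ L {i} p → p ∈L L → Primitive p → ∀ M M′ → Good L M i → Good L M′ i → M ≐L M′
good-unique L {i} p p∈L p-prim M M′ (_ , L⊆M , M-mult) (_ , L⊆M′ , M′-mult) =
  ≐L-trans M M̂ M′ (span-primitive M p M-mult (L⊆M p p∈L) p-prim)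
    (≐L-sym M′ M̂ (span-primitive M′ p M′-mult (L⊆M′ p p∈L) p-prim))
  where
  M̂ = canonical-gens p p-prim (2^₂∞ i)

good-canonical-gens : ∀ L {d j} p → HasMult L d → fin j ≤∞ d → p ∈L L → (p-prim : Primitive p) →
                 Good L (canonical-gens p p-prim (2^₂ j)) (fin j)
good-canonical-gens L p L-mult j≤d p∈L (inj₁ p₁-odd) = good-odd₁ L p L-mult j≤d p∈L p₁-odd
good-canonical-gens L p L-mult j≤d p∈L (inj₂ p₂-odd) = good-odd₂ L p L-mult j≤d p∈L p₂-odd

lemma2 : (L : Gens) → PrimitiveLat L → (d : ℕ∞) → HasMult L d →
    (i : ℕ∞) → i ≤∞ d →
      (Σ Gens λ M → Good L M i)
      × (∀ M M' → Good L M i → Good L M' i → M ≐L M')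
      × (∀ (j : ℕ) → i ≡ fin j →
           (∀ u → u ∈L L → Odd (proj₁ u) → Good L (u , (0₂ , 2^₂ j)) i)
           × (∀ w → w ∈L L → Odd (proj₂ w) → Good L (w , (2^₂ j , 0₂)) i))
      × (i ≡ ∞ → d ≡ ∞ →
           (∀ M → Good L M i → M ≐L L)
           × (∀ w → w ∈L L → Primitive w → L ≐L (w , (0₂ , 0₂))))
lemma2 L (p , p∈L , p-prim) d L-mult (fin j) j≤d =
  (canonical-gens p p-prim (2^₂ j) , good-canonical-gens L p L-mult j≤d p∈L p-prim) ,
  good-unique L p p∈L p-prim ,
  (λ { _ refl → (λ u → good-odd₁ L u L-mult j≤d) , (λ w → good-odd₂ L w L-mult j≤d) }) ,
  (λ ())
lemma2 L (p , p∈L , p-prim) .∞ L-mult ∞ ∞≤∞ =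
  (L , L-good) ,
  good-unique L p p∈L p-prim ,
  (λ _ ()) ,
  λ _ _ → (λ M M-good → good-unique L p p∈L p-prim M L M-good L-good) , L≐[w,0]
  where
  L-good : Good L L ∞
  L-good = (p , p∈L , p-prim) , (λ _ v∈L → v∈L) , L-mult

  L≐[w,0] : ∀ w → w ∈L L → Primitive w → L ≐L (w , (0₂ , 0₂))
  L≐[w,0] w w∈L (inj₁ w₁-odd) = span-odd₁ L w L-mult w∈L w₁-odd
  L≐[w,0] w w∈L (inj₂ w₂-odd) = span-odd₂ L w L-mult w∈L w₂-odd
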